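{- Let $d\ge4$ be a fixed even integer and let $n$ be sufficiently large (depending on $d$). For every binary code $C\subseteq\{0,1\}^n$ of minimum Hamming distance $d$ in which every word has Hamming weight $\frac{d}{2}+1$, there exists a binary code $C''\subseteq\{0,1\}^{n+\frac{d}{2}-1}$ of minimum distance $d$ in which every word has weight $\frac{d}{2}+1$, such that $|C''|=|C|+2$.
   Context: Hamming distance and Hamming weight are the usual ones on $\{0,1\}^n$; the minimum distance of a code is the smallest distance between two distinct codewords. -}

module Defs where

open import Data.Nat using (ℕ; zero; suc; _+_; _≥_)
open import Data.Bool using (Bool; true; false; _xor_)
open import Data.Vec using (Vec; []; _∷_; zipWith; count)
open import Data.List using (List; length)
open import Data.List.Membership.Propositional using (_∈_)
open import Data.List.Relation.Unary.Unique.Propositional using (Unique)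
open import Data.Product using (Σ; _×_; ∃-syntax)
open import Relation.Binary.PropositionalEquality using (_≡_; _≢_)
open import Relation.Nullary using (Dec; yes; no)

Word : ℕ → Set
Word n = Vec Bool n

weight : ∀ {n} → Word n → ℕ
weight [] = 0
weight (true ∷ xs) = suc (weight xs)
weight (false ∷ xs) = weight xs

dist : ∀ {n} → Word n → Word n → ℕ
dist x y = weight (zipWith _xor_ x y)

-- a binary code of length n: a duplicate-free list of words (a finite set)
record Code (n : ℕ) : Set where
  constructor code
  field
    words  : List (Word n)
    unique : Unique words
open Code public

∣_∣ : ∀ {n} → Code n → ℕ
∣ C ∣ = length (words C)

HasMinDist : ∀ {n} → Code n → ℕ → Set
HasMinDist C d =
  ((x y : Word _) → x ∈ words C → y ∈ words C → x ≢ y → dist x y ≥ d)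
  × (∃[ x ] ∃[ y ] (x ∈ words C × y ∈ words C × x ≢ y × dist x y ≡ d))

ConstWeight : ∀ {n} → Code n → ℕ → Set
ConstWeight C w = (x : Word _) → x ∈ words C → weight x ≡ w

module Submission where

-- Words of weight k + 1 at distance ≥ 2k share at most one coordinate, so C is a
-- partial linear space. Since n is large, 2(k + 1) coordinates can be chosen greedily
-- in general position: no word of C contains three of them, two words through
-- disjoint pairs of them meet only among them, and they avoid a pair of words at
-- distance exactly 2k. Split into two groups of k + 1, they form the two new words.
-- A word of C through two points of a group would meet that new word twice; it drops
-- one of the two points and records instead, in the k − 1 new coordinates, the label l
-- for which the dropped point is the l-th shift of the kept one. The kept point and
-- the label determine the dropped point, which is what keeps two repaired words with
-- the same label disjoint on the old coordinates.

open import Defs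
open import Data.Bool using (true; false)
open import Data.Bool.Properties using () renaming (_≟_ to _≟ᵇ_)
open import Data.Empty using (⊥; ⊥-elim)
open import Data.Fin using (Fin; zero; suc; toℕ; fromℕ<; combine)
import Data.Fin.Properties as Fin
open import Data.Fin.Subset as Subset
  using (inside; outside; _∩_; _∪_; _─_; _-_; ⁅_⁆; _⊆_; Empty)
  renaming (⊥ to ∅)
open import Data.Fin.Subset.Properties
  using (⊆-refl; x∈p∩q⁺; x∈p∩q⁻; x∈p∪q⁻; x∈⁅y⁆⇒x≡y; x≢y⇒x∉⁅y⁆; x∈⁅x⁆; p─q⊆p; p─⊥≡p
        ; p⊆q⇒∣p∣≤∣q∣; ∣⊥∣≡0; ∣⁅x⁆∣≡1; Empty-unique; ∪-identityˡ; ∩-comm; ∩-idem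
        ; ∩-zeroˡ; ∩-zeroʳ; drop-there; p∩q⊆p; ∉⊥)
  renaming (_∈?_ to _∈ₛ?_)
open import Data.List as List using (List; length; concatMap; allFin)
open import Data.List.Properties using (length-map; length-++; length-tabulate)
open import Data.List.Membership.Propositional using (_∈_; _∉_; find; lose)
open import Data.List.Membership.Propositional.Properties
  using (∈-map⁺; ∈-map⁻; ∈-allFin; ∈-tabulate⁺; ∈-concatMap⁺; ∈-++⁺ˡ; ∈-++⁺ʳ)
open import Data.List.Relation.Unary.All as All using (All)
import Data.List.Relation.Unary.All.Properties as All
import Data.List.Relation.Unary.AllPairs as AllPairs
open import Data.List.Relation.Unary.Any as Any using (Any)
open import Data.List.Relation.Unary.Unique.Propositional using (Unique)
open import Data.Nat using (ℕ; zero; suc; _+_; _*_; _∸_; _≤_; _<_; _≥_; z≤n; s≤s; _<?_)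
open import Data.Nat.Properties
open import Data.Nat.Tactic.RingSolver using (solve-∀)
open import Data.Product using (_×_; _,_; proj₁; proj₂; ∃₂; ∃-syntax)
open import Data.Sum using (_⊎_; inj₁; inj₂; [_,_]; swap)
open import Data.Vec using ([]; _∷_; _++_; here; there)
open import Data.Vec.Functional using () renaming (_∷_ to _∷ᶠ_)
open import Data.Vec.Properties using (zipWith-++; ≡-dec)
open import Function using (_∘′_)
open import Function.Definitions using (Injective)
open import Relation.Binary.Definitions using (tri<; tri≈; tri>)
open import Relation.Binary.PropositionalEquality hiding ([_])
open import Relation.Nullary using (¬_; yes; no; contradiction; Dec)
open import Relation.Nullary.Decidable using (_×-dec_; ¬?; map′)

private variable
  ℓ m n : ℕ

-- Words as subsets of coordinates

infix 4 _∋_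

_∋_ : Word n → Fin n → Set
w ∋ i = i Subset.∈ w

Subsingleton : Word n → Set
Subsingleton p = ∀ {i j} → p ∋ i → p ∋ j → i ≡ j

weight≡∣∣ : (p : Word n) → weight p ≡ Subset.∣ p ∣
weight≡∣∣ [] = refl
weight≡∣∣ (true ∷ p) = cong suc (weight≡∣∣ p)
weight≡∣∣ (false ∷ p) = weight≡∣∣ p

weight-mono : {p q : Word n} → p ⊆ q → weight p ≤ weight q
weight-mono {p = p} {q} p⊆q =
  subst₂ _≤_ (sym (weight≡∣∣ p)) (sym (weight≡∣∣ q)) (p⊆q⇒∣p∣≤∣q∣ p⊆q)

weight-∅ : ∀ n → weight (∅ {n}) ≡ 0
weight-∅ n = trans (weight≡∣∣ (∅ {n})) (∣⊥∣≡0 n)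

weight-⁅⁆ : (i : Fin n) → weight ⁅ i ⁆ ≡ 1
weight-⁅⁆ i = trans (weight≡∣∣ ⁅ i ⁆) (∣⁅x⁆∣≡1 i)

weight-Empty : {p : Word n} → Empty p → weight p ≡ 0
weight-Empty {n} e = trans (cong weight (Empty-unique e)) (weight-∅ n)

weight-++ : (p : Word m) (q : Word n) → weight (p ++ q) ≡ weight p + weight q
weight-++ [] q = refl
weight-++ (true ∷ p) q = cong suc (weight-++ p q)
weight-++ (false ∷ p) q = weight-++ p q

weight-remove : {p : Word n} {i : Fin n} → p ∋ i → suc (weight (p - i)) ≡ weight p
weight-remove {p = inside ∷ p} {zero} _ = cong (suc ∘′ weight) (p─⊥≡p p)
weight-remove {p = inside ∷ p} {suc i} i∈ = cong suc (weight-remove (drop-there i∈))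
weight-remove {p = outside ∷ p} {suc i} i∈ = weight-remove (drop-there i∈)

weight-⁅⁆∪ : {p : Word n} {i : Fin n} → ¬ p ∋ i → weight (⁅ i ⁆ ∪ p) ≡ suc (weight p)
weight-⁅⁆∪ {p = inside ∷ p} {zero} i∉ = ⊥-elim (i∉ here)
weight-⁅⁆∪ {p = outside ∷ p} {zero} _ = cong (suc ∘′ weight) (∪-identityˡ p)
weight-⁅⁆∪ {p = inside ∷ p} {suc i} i∉ = cong suc (weight-⁅⁆∪ (i∉ ∘′ there))
weight-⁅⁆∪ {p = outside ∷ p} {suc i} i∉ = weight-⁅⁆∪ (i∉ ∘′ there)

x∈p─q⇒x∉q : {p q : Word n} {x : Fin n} → p ─ q ∋ x → ¬ q ∋ x
x∈p─q⇒x∉q {p = _ ∷ p} {q = _ ∷ q} (there x∈) (there x∈q) = x∈p─q⇒x∉q x∈ x∈q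
x∈p─q⇒x∉q {p = inside ∷ p} {q = inside ∷ q} () here
x∈p─q⇒x∉q {p = outside ∷ p} {q = inside ∷ q} () here

∈-remove⁻ : {p : Word n} {a z : Fin n} → p - a ∋ z → p ∋ z × z ≢ a
∈-remove⁻ {p = p} {a} z∈ = p─q⊆p p ⁅ a ⁆ z∈ , λ { refl → x∈p─q⇒x∉q z∈ (x∈⁅x⁆ a) }

weight≤1 : {p : Word n} → Subsingleton p → weight p ≤ 1
weight≤1 {p = []} _ = z≤n
weight≤1 {p = inside ∷ p} single =
  s≤s (≤-reflexive (weight-Empty λ (j , j∈p) → 0≢suc (single here (there j∈p))))
  where
  0≢suc : ∀ {j : Fin n} → zero ≢ suc j
  0≢suc ()
weight≤1 {p = outside ∷ p} single =
  weight≤1 λ i∈p j∈p → Fin.suc-injective (single (there i∈p) (there j∈p))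

2≤weight : {p : Word n} {i j : Fin n} → p ∋ i → p ∋ j → i ≢ j → 2 ≤ weight p
2≤weight {p = p} {i} {j} i∈p j∈p i≢j = begin
  2                       ≡⟨ cong suc (sym (weight-⁅⁆ j)) ⟩
  suc (weight ⁅ j ⁆)      ≡⟨ sym (weight-⁅⁆∪ (x≢y⇒x∉⁅y⁆ i≢j)) ⟩
  weight (⁅ i ⁆ ∪ ⁅ j ⁆)  ≤⟨ weight-mono (λ x∈ → [ ∈p i∈p , ∈p j∈p ] (x∈p∪q⁻ ⁅ i ⁆ ⁅ j ⁆ x∈)) ⟩
  weight p                ∎
  where
  open ≤-Reasoning
  ∈p : ∀ {x y} → p ∋ y → ⁅ y ⁆ ∋ x → p ∋ x
  ∈p {y = y} y∈p x∈⁅y⁆ = subst (p ∋_) (sym (x∈⁅y⁆⇒x≡y y x∈⁅y⁆)) y∈p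

weight≤1⇒Subsingleton : {p : Word n} → weight p ≤ 1 → Subsingleton p
weight≤1⇒Subsingleton w≤1 {i} {j} i∈p j∈p with i Fin.≟ j
... | yes i≡j = i≡j
... | no i≢j = ⊥-elim (<⇒≱ (s≤s w≤1) (2≤weight i∈p j∈p i≢j))

weight-∩-++ : (a c : Word m) (b d : Word n) →
              weight ((a ++ b) ∩ (c ++ d)) ≡ weight (a ∩ c) + weight (b ∩ d)
weight-∩-++ a c b d = trans (cong weight (zipWith-++ _ a b c d)) (weight-++ (a ∩ c) (b ∩ d))

meet-in-head : {a c : Word m} {b d : Word n} → weight (b ∩ d) ≡ 0 → weight (a ∩ c) ≤ 1 →
               weight ((a ++ b) ∩ (c ++ d)) ≤ 1
meet-in-head {a = a} {c} {b} {d} b∩d≡0 a∩c≤1 = subst (_≤ 1)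
  (sym (trans (weight-∩-++ a c b d) (trans (cong (weight (a ∩ c) +_) b∩d≡0) (+-identityʳ _)))) a∩c≤1

meet-in-tail : {a c : Word m} {b d : Word n} → weight (a ∩ c) ≡ 0 → weight (b ∩ d) ≤ 1 →
               weight ((a ++ b) ∩ (c ++ d)) ≤ 1
meet-in-tail {a = a} {c} {b} {d} a∩c≡0 b∩d≤1 = subst (_≤ 1)
  (sym (trans (weight-∩-++ a c b d) (cong (_+ weight (b ∩ d)) a∩c≡0))) b∩d≤1

weight-∅∩ : (q : Word n) → weight (∅ ∩ q) ≡ 0
weight-∅∩ {n} q = trans (cong weight (∩-zeroˡ q)) (weight-∅ n)

weight-∩∅ : (p : Word n) → weight (p ∩ ∅) ≡ 0
weight-∩∅ {n} p = trans (cong weight (∩-zeroʳ p)) (weight-∅ n)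

weight-⁅⁆∩⁅⁆ : {i j : Fin n} → i ≢ j → weight (⁅ i ⁆ ∩ ⁅ j ⁆) ≡ 0
weight-⁅⁆∩⁅⁆ {i = i} {j} i≢j = weight-Empty λ (a , a∈) →
  let a∈⁅i⁆ , a∈⁅j⁆ = x∈p∩q⁻ ⁅ i ⁆ ⁅ j ⁆ a∈
  in i≢j (trans (sym (x∈⁅y⁆⇒x≡y i a∈⁅i⁆)) (x∈⁅y⁆⇒x≡y j a∈⁅j⁆))

weight-⁅⁆∩ : (i : Fin n) (q : Word n) → weight (⁅ i ⁆ ∩ q) ≤ 1
weight-⁅⁆∩ i q = ≤-trans (weight-mono (p∩q⊆p ⁅ i ⁆ q)) (≤-reflexive (weight-⁅⁆ i))

weight-∩-mono : {x x′ y y′ : Word n} → x′ ⊆ x → y′ ⊆ y → weight (x′ ∩ y′) ≤ weight (x ∩ y)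
weight-∩-mono {x′ = x′} {y′ = y′} x′⊆x y′⊆y = weight-mono λ i∈ →
  let i∈x′ , i∈y′ = x∈p∩q⁻ x′ y′ i∈ in x∈p∩q⁺ (x′⊆x i∈x′ , y′⊆y i∈y′)

weight+weight≡dist+2*weight∩ : (x y : Word n) → weight x + weight y ≡ dist x y + 2 * weight (x ∩ y)
weight+weight≡dist+2*weight∩ [] [] = refl
weight+weight≡dist+2*weight∩ (true ∷ x) (true ∷ y) = begin
  suc (weight x + suc (weight y))          ≡⟨ cong suc (+-suc (weight x) (weight y)) ⟩
  suc (suc (weight x + weight y))          ≡⟨ cong (suc ∘′ suc) (weight+weight≡dist+2*weight∩ x y) ⟩
  suc (suc (dist x y + 2 * weight (x ∩ y))) ≡⟨ cong suc (+-suc (dist x y) _) ⟨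
  suc (dist x y + suc (2 * weight (x ∩ y))) ≡⟨ +-suc (dist x y) _ ⟨
  dist x y + suc (suc (2 * weight (x ∩ y))) ≡⟨ cong (dist x y +_) (sym (*-suc 2 (weight (x ∩ y)))) ⟩
  dist x y + 2 * suc (weight (x ∩ y))     ∎
  where open ≡-Reasoning
weight+weight≡dist+2*weight∩ (true ∷ x) (false ∷ y) = cong suc (weight+weight≡dist+2*weight∩ x y)
weight+weight≡dist+2*weight∩ (false ∷ x) (true ∷ y) =
  trans (+-suc (weight x) (weight y)) (cong suc (weight+weight≡dist+2*weight∩ x y))
weight+weight≡dist+2*weight∩ (false ∷ x) (false ∷ y) = weight+weight≡dist+2*weight∩ x y

image : (Fin m → Fin n) → Word n
image {zero} f = ∅
image {suc m} f = ⁅ f zero ⁆ ∪ image (f ∘′ suc)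

∈-image⁻ : (f : Fin m → Fin n) {a : Fin n} → image f ∋ a → ∃[ i ] f i ≡ a
∈-image⁻ {zero} f a∈ = ⊥-elim (∉⊥ a∈)
∈-image⁻ {suc m} f {a} a∈ with x∈p∪q⁻ ⁅ f zero ⁆ (image (f ∘′ suc)) a∈
... | inj₁ a∈⁅f0⁆ = zero , sym (x∈⁅y⁆⇒x≡y (f zero) a∈⁅f0⁆)
... | inj₂ a∈img = let i , fi≡a = ∈-image⁻ (f ∘′ suc) a∈img in suc i , fi≡a

weight-image : (f : Fin m → Fin n) → Injective _≡_ _≡_ f → weight (image f) ≡ m
weight-image {zero} {n} f _ = weight-∅ n
weight-image {suc m} f inj = begin
  weight (⁅ f zero ⁆ ∪ image (f ∘′ suc)) ≡⟨ weight-⁅⁆∪ f0∉ ⟩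
  suc (weight (image (f ∘′ suc)))        ≡⟨ cong suc (weight-image (f ∘′ suc) (Fin.suc-injective ∘′ inj)) ⟩
  suc m                                  ∎
  where
  open ≡-Reasoning
  f0∉ : ¬ image (f ∘′ suc) ∋ f zero
  f0∉ f0∈ with () ← inj (proj₂ (∈-image⁻ (f ∘′ suc) f0∈))

≢-if-∩≤1 : {a b : Word n} → 2 ≤ weight a → weight (a ∩ b) ≤ 1 → a ≢ b
≢-if-∩≤1 {a = a} 2≤a a∩b≤1 refl = <⇒≱ (s≤s a∩b≤1) (subst (2 ≤_) (cong weight (sym (∩-idem a))) 2≤a)

constant-weight-dist : ∀ {k} (x y : Word n) → weight x ≡ k + 1 → weight y ≡ k + 1 →
                       (k + 1) + (k + 1) ≡ dist x y + 2 * weight (x ∩ y)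
constant-weight-dist x y wx wy = trans (sym (cong₂ _+_ wx wy)) (weight+weight≡dist+2*weight∩ x y)

module _ {k d c : ℕ} (eq : (k + 1) + (k + 1) ≡ d + 2 * c) where

  private
    eq′ : 2 * k + 2 ≡ d + 2 * c
    eq′ = trans (double k) eq
      where
      double : ∀ k → 2 * k + 2 ≡ (k + 1) + (k + 1)
      double = solve-∀

  2k≤d⇒c≤1 : 2 * k ≤ d → c ≤ 1
  2k≤d⇒c≤1 2k≤d = *-cancelˡ-≤ 2 (+-cancelˡ-≤ (2 * k) (2 * c) 2 (begin
    2 * k + 2 * c ≤⟨ +-monoˡ-≤ (2 * c) 2k≤d ⟩
    d + 2 * c     ≡⟨ eq′ ⟨
    2 * k + 2     ∎))
    where open ≤-Reasoning

  c≤1⇒2k≤d : c ≤ 1 → 2 * k ≤ d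
  c≤1⇒2k≤d c≤1 = +-cancelʳ-≤ 2 (2 * k) d (begin
    2 * k + 2 ≡⟨ eq′ ⟩
    d + 2 * c ≤⟨ +-monoʳ-≤ d (*-monoʳ-≤ 2 c≤1) ⟩
    d + 2     ∎)
    where open ≤-Reasoning

  c≡1⇒d≡2k : c ≡ 1 → d ≡ 2 * k
  c≡1⇒d≡2k refl = sym (+-cancelʳ-≡ 2 (2 * k) d eq′)

  d≡2k⇒c≡1 : d ≡ 2 * k → c ≡ 1
  d≡2k⇒c≡1 refl = *-cancelˡ-≡ c 1 2 (sym (+-cancelˡ-≡ (2 * k) 2 (2 * c) eq′))

-- c + l + 1, where every overflow lands on 0 (only the step from m to 0 is ever used).
shift : Fin (suc m) → Fin ℓ → Fin (suc m)
shift {m} c l with toℕ c + toℕ l <? m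
... | yes fits = fromℕ< (s≤s fits)
... | no _ = zero

toℕ-shift : (c : Fin (suc m)) (l : Fin ℓ) → toℕ c + toℕ l < m → toℕ (shift c l) ≡ suc (toℕ c + toℕ l)
toℕ-shift {m} c l fits with toℕ c + toℕ l <? m
... | yes fits′ = Fin.toℕ-fromℕ< (s≤s fits′)
... | no ¬fits = contradiction fits ¬fits

shift-overflow : (c : Fin (suc m)) (l : Fin ℓ) → ¬ toℕ c + toℕ l < m → shift c l ≡ zero
shift-overflow {m} c l ¬fits with toℕ c + toℕ l <? m
... | yes fits = contradiction fits ¬fits
... | no _ = refl

Reaches : Fin (suc m) → Fin (suc m) → ℕ → Set
Reaches i j ℓ = ∃[ l ] shift {ℓ = ℓ} i l ≡ j

shift-connects< : 1 ≤ ℓ → m ∸ 1 ≤ ℓ → (i j : Fin (suc m)) → toℕ i < toℕ j → Reaches i j ℓ ⊎ Reaches j i ℓ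
shift-connects< {suc ℓ} {m} _ m∸1≤ℓ i j i<j with toℕ j ∸ suc (toℕ i) <? suc ℓ
... | yes d<ℓ = inj₁ (l , Fin.toℕ-injective (trans (toℕ-shift i l fits) i+l+1≡j))
  where
  l : Fin (suc ℓ)
  l = fromℕ< d<ℓ
  i+l+1≡j : suc (toℕ i + toℕ l) ≡ toℕ j
  i+l+1≡j = trans (cong (λ t → suc (toℕ i + t)) (Fin.toℕ-fromℕ< d<ℓ)) (m+[n∸m]≡n i<j)
  fits : toℕ i + toℕ l < m
  fits = ≤-pred (subst (_< suc m) (sym i+l+1≡j) (Fin.toℕ<n j))
... | no d≮ℓ = inj₂ (zero , trans (shift-overflow j zero (≤⇒≯ m≤j+0)) (sym i≡0))
  where
  d : ℕ
  d = toℕ j ∸ suc (toℕ i)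
  i+d+1≡j : suc (toℕ i + d) ≡ toℕ j
  i+d+1≡j = m+[n∸m]≡n i<j
  m≤d+1 : m ≤ suc d
  m≤d+1 = ≤-trans (m≤n+m∸n m 1) (s≤s (≤-trans m∸1≤ℓ (≮⇒≥ d≮ℓ)))
  i≡0 : i ≡ zero
  i≡0 = Fin.toℕ-injective (n≤0⇒n≡0 (+-cancelʳ-≤ d (toℕ i) 0
    (≤-pred (≤-trans (≤-reflexive i+d+1≡j) (≤-trans (≤-pred (Fin.toℕ<n j)) m≤d+1)))))
  m≤j+0 : m ≤ toℕ j + 0
  m≤j+0 = ≤-trans m≤d+1 (≤-trans (s≤s (m≤n+m d (toℕ i)))
    (≤-reflexive (trans i+d+1≡j (sym (+-identityʳ _)))))

shift-connects : 1 ≤ ℓ → m ∸ 1 ≤ ℓ → (i j : Fin (suc m)) → i ≢ j → Reaches i j ℓ ⊎ Reaches j i ℓ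
shift-connects 1≤ℓ m∸1≤ℓ i j i≢j with <-cmp (toℕ i) (toℕ j)
... | tri< i<j _ _ = shift-connects< 1≤ℓ m∸1≤ℓ i j i<j
... | tri≈ _ i≡j _ = contradiction (Fin.toℕ-injective i≡j) i≢j
... | tri> _ _ j<i = swap (shift-connects< 1≤ℓ m∸1≤ℓ j i j<i)

-- Sparse sets of points, chosen greedily

points : Word n → List (Fin n)
points [] = List.[]
points (true ∷ w) = zero List.∷ List.map suc (points w)
points (false ∷ w) = List.map suc (points w)

∈-points : {w : Word n} {i : Fin n} → w ∋ i → i ∈ points w
∈-points {w = true ∷ w} here = Any.here refl
∈-points {w = true ∷ w} (there i∈w) = Any.there (∈-map⁺ suc (∈-points i∈w))
∈-points {w = false ∷ w} (there i∈w) = ∈-map⁺ suc (∈-points i∈w)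

length-points : (w : Word n) → length (points w) ≡ weight w
length-points [] = refl
length-points (true ∷ w) = cong suc (trans (length-map suc (points w)) (length-points w))
length-points (false ∷ w) = trans (length-map suc (points w)) (length-points w)

length-concatMap-≤ : {A B : Set} {c : ℕ} (f : A → List B) → (∀ x → length (f x) ≤ c) →
                     (xs : List A) → length (concatMap f xs) ≤ length xs * c
length-concatMap-≤ f f≤c List.[] = z≤n
length-concatMap-≤ f f≤c (x List.∷ xs) =
  ≤-trans (≤-reflexive (length-++ (f x))) (+-mono-≤ (f≤c x) (length-concatMap-≤ f f≤c xs))

∃∉ : (xs : List (Fin n)) → length xs < n → ∃[ s ] s ∉ xs
∃∉ {n} xs len = Fin.¬∀⟶∃¬ n (_∈ xs) (_∈? xs) λ all∈ →
  <⇒≱ len (Fin.injective⇒≤ λ {i} {j} → index-injective (setoid (Fin n)) (all∈ i) (all∈ j))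
  where
  open import Data.List.Membership.DecPropositional Fin._≟_ using (_∈?_)
  open import Data.List.Membership.Setoid.Properties using (index-injective)

Linear : List (Word n) → Set
Linear ws = ∀ {x y} → x ∈ ws → y ∈ ws → x ≢ y → Subsingleton (x ∩ y)

module Sparsity {n} (ws : List (Word n)) (avoid : List (Fin n)) where

  Secant : (Fin m → Fin n) → Word n → Set
  Secant σ w = ∃₂ λ i j → σ i ≢ σ j × w ∋ σ i × w ∋ σ j

  record Sparse (σ : Fin m → Fin n) : Set where
    field
      injective   : Injective _≡_ _≡_ σ
      avoids      : ∀ i → σ i ∉ avoid
      no-three    : ∀ {w i j l} → w ∈ ws → σ i ≢ σ j → σ i ≢ σ l → σ j ≢ σ l →
                    w ∋ σ i → w ∋ σ j → w ∋ σ l → ⊥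
      no-crossing : ∀ {w₁ w₂ z} → w₁ ∈ ws → w₂ ∈ ws → w₁ ≢ w₂ → Secant σ w₁ → Secant σ w₂ →
                    w₁ ∋ z → w₂ ∋ z → (∀ t → σ t ≢ z) → ⊥

  sparse-[] : Sparse {0} (λ ())
  sparse-[] = record
    { injective   = λ { {()} }
    ; avoids      = λ ()
    ; no-three    = λ { {i = ()} }
    ; no-crossing = λ { _ _ _ (() , _) }
    }

-- m chosen points, the avoided ones, the lines (words, of K points) through two chosen
-- points, and the lines through a chosen point and a point of one of those.
forbidden-bound : (K A m : ℕ) → ℕ
forbidden-bound K A m = m + (A + (m * (m * K) + m * (m * (m * K) * K)))

forbidden-bound-mono : ∀ K A {m m′ : ℕ} → m ≤ m′ → forbidden-bound K A m ≤ forbidden-bound K A m′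
forbidden-bound-mono K A {m} {m′} m≤m′ = +-mono-≤ m≤m′ (+-monoʳ-≤ A (+-mono-≤ m²K-mono
  (*-mono-≤ m≤m′ (*-monoˡ-≤ K m²K-mono))))
  where
  m²K-mono : m * (m * K) ≤ m′ * (m′ * K)
  m²K-mono = *-mono-≤ m≤m′ (*-monoˡ-≤ K m≤m′)

module Greedy {n K} {ws : List (Word n)} (weights : ∀ {w} → w ∈ ws → weight w ≡ K)
              (linear : Linear ws) (avoid : List (Fin n)) where

  open Sparsity ws avoid

  through? : (a b : Fin n) → Dec (Any (λ w → w ∋ a × w ∋ b) ws)
  through? a b = Any.any? (λ w → (a ∈ₛ? w) ×-dec (b ∈ₛ? w)) ws

  line : Fin n → Fin n → List (Fin n)
  line a b with through? a b
  ... | yes on-some = points (proj₁ (find on-some))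
  ... | no _ = List.[]

  ∈-line : ∀ {w a b z} → w ∈ ws → a ≢ b → w ∋ a → w ∋ b → w ∋ z → z ∈ line a b
  ∈-line {w} {a} {b} w∈ a≢b a∈w b∈w z∈w with through? a b
  ... | no none = contradiction (lose w∈ (a∈w , b∈w)) none
  ... | yes on-some with find on-some
  ...   | w′ , w′∈ , a∈w′ , b∈w′ with ≡-dec _≟ᵇ_ w′ w
  ...     | yes refl = ∈-points z∈w
  ...     | no w′≢w = contradiction (linear w′∈ w∈ w′≢w (x∈p∩q⁺ (a∈w′ , a∈w)) (x∈p∩q⁺ (b∈w′ , b∈w))) a≢b

  length-line : ∀ a b → length (line a b) ≤ K
  length-line a b with through? a b
  ... | yes on-some = let w , w∈ , _ = find on-some in ≤-reflexive (trans (length-points w) (weights w∈))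
  ... | no _ = z≤n

  secantPoints : (Fin m → Fin n) → List (Fin n)
  secantPoints {m} σ = concatMap (λ i → concatMap (λ j → line (σ i) (σ j)) (allFin m)) (allFin m)

  crossingPoints : (Fin m → Fin n) → List (Fin n)
  crossingPoints {m} σ = concatMap (λ i → concatMap (line (σ i)) (secantPoints σ)) (allFin m)

  forbidden : (Fin m → Fin n) → List (Fin n)
  forbidden σ = List.tabulate σ List.++ (avoid List.++ (secantPoints σ List.++ crossingPoints σ))

  ∈-secantPoints : ∀ {σ : Fin m → Fin n} {w i j z} → w ∈ ws → σ i ≢ σ j →
                   w ∋ σ i → w ∋ σ j → w ∋ z → z ∈ secantPoints σ
  ∈-secantPoints {i = i} {j} w∈ σi≢σj i∈w j∈w z∈w =
    ∈-concatMap⁺ _ (lose (∈-allFin i) (∈-concatMap⁺ _ (lose (∈-allFin j) (∈-line w∈ σi≢σj i∈w j∈w z∈w))))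

  ∈-crossingPoints : ∀ {σ : Fin m → Fin n} {w i z t} → z ∈ secantPoints σ → w ∈ ws → σ i ≢ z →
                     w ∋ σ i → w ∋ z → w ∋ t → t ∈ crossingPoints σ
  ∈-crossingPoints {i = i} z∈ w∈ σi≢z i∈w z∈w t∈w =
    ∈-concatMap⁺ _ (lose (∈-allFin i) (∈-concatMap⁺ _ (lose z∈ (∈-line w∈ σi≢z i∈w z∈w t∈w))))

  length-forbidden : (σ : Fin m → Fin n) → length (forbidden σ) ≤ forbidden-bound K (length avoid) m
  length-forbidden {m} σ = begin
    length (forbidden σ)                             ≡⟨ length-++ (List.tabulate σ) ⟩
    length (List.tabulate σ) + length (avoid List.++ (secantPoints σ List.++ crossingPoints σ))
      ≡⟨ cong₂ _+_ (length-tabulate σ)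
           (trans (length-++ avoid) (cong (length avoid +_) (length-++ (secantPoints σ)))) ⟩
    m + (length avoid + (length (secantPoints σ) + length (crossingPoints σ)))
      ≤⟨ +-monoʳ-≤ m (+-monoʳ-≤ (length avoid) (+-mono-≤ secants≤ crossings≤)) ⟩
    forbidden-bound K (length avoid) m               ∎
    where
    open ≤-Reasoning
    count-allFin : ∀ {c} (f : Fin m → List (Fin n)) → (∀ i → length (f i) ≤ c) →
                   length (concatMap f (allFin m)) ≤ m * c
    count-allFin f f≤c = subst (λ l → length (concatMap f (allFin m)) ≤ l * _)
      (length-tabulate {n = m} (λ i → i)) (length-concatMap-≤ f f≤c (allFin m))
    secants≤ : length (secantPoints σ) ≤ m * (m * K)
    secants≤ = count-allFin _ λ i → count-allFin _ λ j → length-line (σ i) (σ j)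
    crossings≤ : length (crossingPoints σ) ≤ m * (m * (m * K) * K)
    crossings≤ = count-allFin _ λ i →
      ≤-trans (length-concatMap-≤ (line (σ i)) (length-line (σ i)) (secantPoints σ)) (*-monoˡ-≤ K secants≤)

  module _ {σ : Fin m → Fin n} (sparse : Sparse σ) {s : Fin n} (s∉ : s ∉ forbidden σ) where

    open Sparse sparse

    private
      s≢σ : ∀ i → s ≢ σ i
      s≢σ i s≡σi = s∉ (∈-++⁺ˡ (subst (_∈ List.tabulate σ) (sym s≡σi) (∈-tabulate⁺ i)))

      s∉avoid : s ∉ avoid
      s∉avoid s∈ = s∉ (∈-++⁺ʳ (List.tabulate σ) (∈-++⁺ˡ s∈))

      s-off-secants : ∀ {w i j} → w ∈ ws → σ i ≢ σ j → w ∋ σ i → w ∋ σ j → ¬ w ∋ s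
      s-off-secants w∈ σi≢σj i∈w j∈w s∈w =
        s∉ (∈-++⁺ʳ (List.tabulate σ) (∈-++⁺ʳ avoid (∈-++⁺ˡ (∈-secantPoints {σ = σ} w∈ σi≢σj i∈w j∈w s∈w))))

      s-off-crossings : ∀ {w w′ j z} → w ∈ ws → w′ ∈ ws → Secant σ w′ → w ∋ z → w′ ∋ z →
                        (∀ t → σ t ≢ z) → w ∋ σ j → ¬ w ∋ s
      s-off-crossings {j = j} w∈ w′∈ (a , b , σa≢σb , a∈w′ , b∈w′) z∈w z∈w′ z∉σ j∈w s∈w =
        s∉ (∈-++⁺ʳ (List.tabulate σ) (∈-++⁺ʳ avoid (∈-++⁺ʳ (secantPoints σ)
          (∈-crossingPoints {σ = σ} (∈-secantPoints {σ = σ} w′∈ σa≢σb a∈w′ b∈w′ z∈w′)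
            w∈ (z∉σ j) j∈w z∈w s∈w))))

      secant-view : ∀ {w} → Secant (s ∷ᶠ σ) w → (w ∋ s × ∃[ j ] w ∋ σ j) ⊎ Secant σ w
      secant-view (zero , zero , s≢s , _) = contradiction refl s≢s
      secant-view (zero , suc j , _ , s∈w , j∈w) = inj₁ (s∈w , j , j∈w)
      secant-view (suc i , zero , _ , i∈w , s∈w) = inj₁ (s∈w , i , i∈w)
      secant-view (suc i , suc j , σi≢σj , i∈w , j∈w) = inj₂ (i , j , σi≢σj , i∈w , j∈w)

    sparse-∷ : Sparse (s ∷ᶠ σ)
    sparse-∷ = record
      { injective   = injective′
      ; avoids      = λ { zero → s∉avoid ; (suc i) → avoids i }
      ; no-three    = λ {w} {i} {j} {l} → no-three′ {w} {i} {j} {l}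
      ; no-crossing = no-crossing′
      }
      where
      injective′ : Injective _≡_ _≡_ (s ∷ᶠ σ)
      injective′ {zero} {zero} _ = refl
      injective′ {zero} {suc j} s≡σj = contradiction s≡σj (s≢σ j)
      injective′ {suc i} {zero} σi≡s = contradiction (sym σi≡s) (s≢σ i)
      injective′ {suc i} {suc j} σi≡σj = cong suc (injective σi≡σj)

      no-three′ : ∀ {w i j l} → w ∈ ws → (s ∷ᶠ σ) i ≢ (s ∷ᶠ σ) j → (s ∷ᶠ σ) i ≢ (s ∷ᶠ σ) l →
                  (s ∷ᶠ σ) j ≢ (s ∷ᶠ σ) l → w ∋ (s ∷ᶠ σ) i → w ∋ (s ∷ᶠ σ) j → w ∋ (s ∷ᶠ σ) l → ⊥
      no-three′ {i = zero} {zero} _ s≢s _ _ = contradiction refl s≢s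
      no-three′ {i = zero} {suc _} {zero} _ _ s≢s _ = contradiction refl s≢s
      no-three′ {i = suc _} {zero} {zero} _ _ _ s≢s = contradiction refl s≢s
      no-three′ {i = zero} {suc _} {suc _} w∈ _ _ ne s∈ j∈ l∈ = s-off-secants w∈ ne j∈ l∈ s∈
      no-three′ {i = suc _} {zero} {suc _} w∈ _ ne _ i∈ s∈ l∈ = s-off-secants w∈ ne i∈ l∈ s∈
      no-three′ {i = suc _} {suc _} {zero} w∈ ne _ _ i∈ j∈ s∈ = s-off-secants w∈ ne i∈ j∈ s∈
      no-three′ {i = suc _} {suc _} {suc _} w∈ = no-three w∈

      no-crossing′ : ∀ {w₁ w₂ z} → w₁ ∈ ws → w₂ ∈ ws → w₁ ≢ w₂ → Secant (s ∷ᶠ σ) w₁ → Secant (s ∷ᶠ σ) w₂ →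
                     w₁ ∋ z → w₂ ∋ z → (∀ t → (s ∷ᶠ σ) t ≢ z) → ⊥
      no-crossing′ w₁∈ w₂∈ w₁≢w₂ sec₁ sec₂ z∈₁ z∈₂ z∉ with secant-view sec₁ | secant-view sec₂
      ... | inj₁ (s∈₁ , _) | inj₁ (s∈₂ , _) =
        z∉ zero (linear w₁∈ w₂∈ w₁≢w₂ (x∈p∩q⁺ (s∈₁ , s∈₂)) (x∈p∩q⁺ (z∈₁ , z∈₂)))
      ... | inj₁ (s∈₁ , _ , j∈₁) | inj₂ sec₂′ =
        s-off-crossings w₁∈ w₂∈ sec₂′ z∈₁ z∈₂ (λ t → z∉ (suc t)) j∈₁ s∈₁
      ... | inj₂ sec₁′ | inj₁ (s∈₂ , _ , j∈₂) =
        s-off-crossings w₂∈ w₁∈ sec₁′ z∈₂ z∈₁ (λ t → z∉ (suc t)) j∈₂ s∈₂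
      ... | inj₂ sec₁′ | inj₂ sec₂′ = no-crossing w₁∈ w₂∈ w₁≢w₂ sec₁′ sec₂′ z∈₁ z∈₂ (λ t → z∉ (suc t))

  sparse-exists : ∀ M → forbidden-bound K (length avoid) M < n → ∃[ σ ] Sparse {M} σ
  sparse-exists M bound<n = build M ≤-refl
    where
    build : ∀ m → m ≤ M → ∃[ σ ] Sparse {m} σ
    build zero _ = (λ ()) , sparse-[]
    build (suc m) m<M =
      let σ , sparse = build m (<⇒≤ m<M)
          s , s∉ = ∃∉ (forbidden σ) (≤-<-trans (length-forbidden σ)
                     (≤-<-trans (forbidden-bound-mono K (length avoid) (<⇒≤ m<M)) bound<n))
      in s ∷ᶠ σ , sparse-∷ sparse s∉

-- Repairing the code

map⁺-on : {A B : Set} {f : A → B} {xs : List A} → (∀ {x y} → x ∈ xs → y ∈ xs → x ≢ y → f x ≢ f y) →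
          Unique xs → Unique (List.map f xs)
map⁺-on f-inj AllPairs.[] = AllPairs.[]
map⁺-on f-inj (x∉xs AllPairs.∷ uniq) =
  All.map⁺ (All.tabulate λ y∈ → f-inj (Any.here refl) (Any.there y∈) (All.lookup x∉xs y∈))
  AllPairs.∷ map⁺-on (λ x∈ y∈ → f-inj (Any.there x∈) (Any.there y∈)) uniq

module Extension {k n} (2≤k : 2 ≤ k) {ws : List (Word n)}
                 (weights : ∀ {w} → w ∈ ws → weight w ≡ k + 1) (linear : Linear ws)
                 {avoid : List (Fin n)} {σ : Fin (2 * suc k) → Fin n}
                 (sparse : Sparsity.Sparse ws avoid σ) where

  open Sparsity ws avoid using (Secant)
  open Sparsity.Sparse sparse

  L : ℕ
  L = k ∸ 1

  point : Fin 2 → Fin (suc k) → Fin n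
  point h i = σ (combine h i)

  point-injective : ∀ {h h′ i i′} → point h i ≡ point h′ i′ → h ≡ h′ × i ≡ i′
  point-injective {h} {h′} {i} {i′} eq = Fin.combine-injective h i h′ i′ (injective eq)

  record Pinch (w : Word n) : Set where
    constructor pinch
    field
      group      : Fin 2
      keep       : Fin (suc k)
      label      : Fin L
      keep≢shift : keep ≢ shift keep label
      ∋kept      : w ∋ point group keep
      ∋dropped   : w ∋ point group (shift keep label)

    kept dropped : Fin n
    kept = point group keep
    dropped = point group (shift keep label)

    kept≢dropped : kept ≢ dropped
    kept≢dropped = keep≢shift ∘′ proj₂ ∘′ point-injective {group} {group}

    secant : Secant σ w
    secant = combine group keep , combine group (shift keep label) , kept≢dropped , ∋kept , ∋dropped

  open Pinch

  pinch? : (w : Word n) → Dec (Pinch w)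
  pinch? w = map′ (λ (h , c , l , c≢ , c∈ , d∈) → pinch h c l c≢ c∈ d∈)
                  (λ (pinch h c l c≢ c∈ d∈) → h , c , l , c≢ , c∈ , d∈)
    (Fin.any? λ h → Fin.any? λ c → Fin.any? λ l →
      ¬? (c Fin.≟ shift c l) ×-dec point h c ∈ₛ? w ×-dec point h (shift c l) ∈ₛ? w)

  extendWith : (w : Word n) → Dec (Pinch w) → Word (n + L)
  extendWith w (yes p) = (w - dropped p) ++ ⁅ label p ⁆
  extendWith w (no _) = w ++ ∅

  extend : Word n → Word (n + L)
  extend w = extendWith w (pinch? w)

  block : Fin 2 → Word (n + L)
  block h = image (point h) ++ ∅

  third-point-kept : ∀ {w t} → w ∈ ws → (p : Pinch w) → w ∋ σ t → σ t ≢ dropped p → σ t ≡ kept p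
  third-point-kept {w} {t} w∈ p t∈w t≢dropped with σ t Fin.≟ kept p
  ... | yes t≡kept = t≡kept
  ... | no t≢kept = ⊥-elim (no-three {i = combine (group p) (keep p)}
    {combine (group p) (shift (keep p) (label p))} w∈ (kept≢dropped p) (t≢kept ∘′ sym) (t≢dropped ∘′ sym) (∋kept p) (∋dropped p) t∈w)

  pinch-from : ∀ {w h i j} → i ≢ j → w ∋ point h i → w ∋ point h j → Pinch w
  pinch-from {h = h} {i} {j} i≢j i∈w j∈w with shift-connects (m+n≤o⇒m≤o∸n 1 2≤k) ≤-refl i j i≢j
  ... | inj₁ (l , refl) = pinch h i l i≢j i∈w j∈w
  ... | inj₂ (l , refl) = pinch h j l (i≢j ∘′ sym) j∈w i∈w

  weight-extendWith : ∀ {w} → w ∈ ws → (d : Dec (Pinch w)) → weight (extendWith w d) ≡ k + 1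
  weight-extendWith {w} w∈ (yes p) = begin
    weight ((w - dropped p) ++ ⁅ label p ⁆)     ≡⟨ weight-++ (w - dropped p) ⁅ label p ⁆ ⟩
    weight (w - dropped p) + weight ⁅ label p ⁆ ≡⟨ cong (weight (w - dropped p) +_) (weight-⁅⁆ (label p)) ⟩
    weight (w - dropped p) + 1                  ≡⟨ +-comm _ 1 ⟩
    suc (weight (w - dropped p))                ≡⟨ weight-remove (∋dropped p) ⟩
    weight w                                    ≡⟨ weights w∈ ⟩
    k + 1                                       ∎
    where open ≡-Reasoning
  weight-extendWith {w} w∈ (no _) = begin
    weight (w ++ ∅)           ≡⟨ weight-++ w ∅ ⟩
    weight w + weight (∅ {L}) ≡⟨ cong₂ _+_ (weights w∈) (weight-∅ L) ⟩
    k + 1 + 0                 ≡⟨ +-identityʳ _ ⟩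
    k + 1                     ∎
    where open ≡-Reasoning

  weight-block : ∀ h → weight (block h) ≡ k + 1
  weight-block h = begin
    weight (image (point h) ++ ∅)             ≡⟨ weight-++ (image (point h)) ∅ ⟩
    weight (image (point h)) + weight (∅ {L}) ≡⟨ cong₂ _+_ (weight-image (point h) (proj₂ ∘′ point-injective {h} {h}))
                                                             (weight-∅ L) ⟩
    suc k + 0                                 ≡⟨ +-identityʳ _ ⟩
    suc k                                     ≡⟨ +-comm 1 k ⟩
    k + 1                                     ∎
    where open ≡-Reasoning

  weight-∩≤1 : ∀ {x y x′ y′} → x ∈ ws → y ∈ ws → x ≢ y → x′ ⊆ x → y′ ⊆ y → weight (x′ ∩ y′) ≤ 1
  weight-∩≤1 x∈ y∈ x≢y x′⊆x y′⊆y = ≤-trans (weight-∩-mono x′⊆x y′⊆y) (weight≤1 (linear x∈ y∈ x≢y))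

  -- A common point outside σ is excluded by no-crossing; one inside σ is the kept point
  -- of both words, and then equal labels make the dropped points a second common point.
  pinched-apart : ∀ {x y} → x ∈ ws → y ∈ ws → x ≢ y → (p : Pinch x) (q : Pinch y) → label p ≡ label q →
                  ∀ {z} → x ∋ z → z ≢ dropped p → y ∋ z → z ≢ dropped q → ⊥
  pinched-apart {x} {y} x∈ y∈ x≢y p q same-label {z} z∈x z≢dp z∈y z≢dq with Fin.any? (λ t → σ t Fin.≟ z)
  ... | no z∉σ = no-crossing x∈ y∈ x≢y (secant p) (secant q) z∈x z∈y (λ t σt≡z → z∉σ (t , σt≡z))
  ... | yes (t , refl) = z≢dp (sym (linear x∈ y∈ x≢y (x∈p∩q⁺ (∋dropped p , dp∈y)) (x∈p∩q⁺ (z∈x , z∈y))))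
    where
    dp≡dq : dropped p ≡ dropped q
    dp≡dq =
      let same-group , same-keep = point-injective {group p} {group q} {keep p} {keep q}
            (trans (sym (third-point-kept x∈ p z∈x z≢dp)) (third-point-kept y∈ q z∈y z≢dq))
      in cong₂ point same-group (cong₂ shift same-keep same-label)
    dp∈y : y ∋ dropped p
    dp∈y = subst (y ∋_) (sym dp≡dq) (∋dropped q)

  extendWith-∩ : ∀ {x y} → x ∈ ws → y ∈ ws → x ≢ y → (d : Dec (Pinch x)) (e : Dec (Pinch y)) →
                 weight (extendWith x d ∩ extendWith y e) ≤ 1
  extendWith-∩ {x} {y} x∈ y∈ x≢y (no _) (no _) =
    meet-in-head {a = x} {c = y} (weight-∅∩ (∅ {L})) (weight-∩≤1 x∈ y∈ x≢y ⊆-refl ⊆-refl)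
  extendWith-∩ {x} {y} x∈ y∈ x≢y (no _) (yes q) =
    meet-in-head {a = x} {c = y - dropped q} (weight-∅∩ ⁅ label q ⁆)
      (weight-∩≤1 x∈ y∈ x≢y ⊆-refl (p─q⊆p y ⁅ dropped q ⁆))
  extendWith-∩ {x} {y} x∈ y∈ x≢y (yes p) (no _) =
    meet-in-head {a = x - dropped p} {c = y} (weight-∩∅ ⁅ label p ⁆)
      (weight-∩≤1 x∈ y∈ x≢y (p─q⊆p x ⁅ dropped p ⁆) ⊆-refl)
  extendWith-∩ {x} {y} x∈ y∈ x≢y (yes p) (yes q) with label p Fin.≟ label q
  ... | no lp≢lq = meet-in-head {a = x - dropped p} {c = y - dropped q} (weight-⁅⁆∩⁅⁆ lp≢lq)
    (weight-∩≤1 x∈ y∈ x≢y (p─q⊆p x ⁅ dropped p ⁆) (p─q⊆p y ⁅ dropped q ⁆))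
  ... | yes lp≡lq =
    meet-in-tail {a = x - dropped p} {c = y - dropped q} (weight-Empty apart) (weight-⁅⁆∩ (label p) ⁅ label q ⁆)
    where
    apart : Empty ((x - dropped p) ∩ (y - dropped q))
    apart (z , z∈) =
      let z∈x′ , z∈y′ = x∈p∩q⁻ (x - dropped p) (y - dropped q) z∈
          z∈x , z≢dp = ∈-remove⁻ z∈x′
          z∈y , z≢dq = ∈-remove⁻ z∈y′
      in pinched-apart x∈ y∈ x≢y p q lp≡lq z∈x z≢dp z∈y z≢dq

  block-∩-extendWith : ∀ {y} h → y ∈ ws → (e : Dec (Pinch y)) → weight (block h ∩ extendWith y e) ≤ 1
  block-∩-extendWith {y} h y∈ (no unpinched) =
    meet-in-head {a = image (point h)} (weight-∅∩ (∅ {L})) (weight≤1 single)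
    where
    single : Subsingleton (image (point h) ∩ y)
    single a∈ b∈ with x∈p∩q⁻ (image (point h)) y a∈ | x∈p∩q⁻ (image (point h)) y b∈
    ... | a∈img , a∈y | b∈img , b∈y with ∈-image⁻ (point h) a∈img | ∈-image⁻ (point h) b∈img
    ...   | i , refl | j , refl with i Fin.≟ j
    ...     | yes refl = refl
    ...     | no i≢j = contradiction (pinch-from {h = h} i≢j a∈y b∈y) unpinched
  block-∩-extendWith {y} h y∈ (yes p) =
    meet-in-head {a = image (point h)} (weight-∅∩ ⁅ label p ⁆) (weight≤1 single)
    where
    on-kept : ∀ {a} → image (point h) ∩ (y - dropped p) ∋ a → a ≡ kept p
    on-kept a∈ with x∈p∩q⁻ (image (point h)) (y - dropped p) a∈
    ... | a∈img , a∈y′ with ∈-image⁻ (point h) a∈img | ∈-remove⁻ a∈y′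
    ...   | i , refl | a∈y , a≢dp = third-point-kept y∈ p a∈y a≢dp
    single : Subsingleton (image (point h) ∩ (y - dropped p))
    single a∈ b∈ = trans (on-kept a∈) (sym (on-kept b∈))

  block-∩-block : ∀ {h h′} → h ≢ h′ → weight (block h ∩ block h′) ≤ 1
  block-∩-block {h} {h′} h≢h′ =
    meet-in-head {a = image (point h)} {c = image (point h′)} (weight-∅∩ (∅ {L}))
      (≤-trans (≤-reflexive (weight-Empty apart)) z≤n)
    where
    apart : Empty (image (point h) ∩ image (point h′))
    apart (a , a∈) with x∈p∩q⁻ (image (point h)) (image (point h′)) a∈
    ... | a∈img , a∈img′ with ∈-image⁻ (point h) a∈img | ∈-image⁻ (point h′) a∈img′
    ...   | i , refl | j , σj≡σi = h≢h′ (sym (proj₁ (point-injective {h′} {h} σj≡σi)))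

  extend-avoiding : ∀ {w} → (∀ {i} → w ∋ i → i ∈ avoid) → extend w ≡ w ++ ∅
  extend-avoiding {w} w⊆avoid with pinch? w
  ... | yes p = contradiction (w⊆avoid (∋kept p)) (avoids (combine (group p) (keep p)))
  ... | no _ = refl

  newWords : List (Word (n + L))
  newWords = block zero List.∷ block (suc zero) List.∷ List.map extend ws

  data NewWord : Word (n + L) → Set where
    block-word    : ∀ h → NewWord (block h)
    extended-word : ∀ {x} → x ∈ ws → NewWord (extend x)

  newWord : ∀ {a} → a ∈ newWords → NewWord a
  newWord (Any.here refl) = block-word zero
  newWord (Any.there (Any.here refl)) = block-word (suc zero)
  newWord (Any.there (Any.there a∈)) with ∈-map⁻ extend a∈
  ... | x , x∈ , refl = extended-word x∈

  weight-new : ∀ {a} → NewWord a → weight a ≡ k + 1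
  weight-new (block-word h) = weight-block h
  weight-new (extended-word x∈) = weight-extendWith x∈ (pinch? _)

  ∩-new : ∀ {a b} → NewWord a → NewWord b → a ≢ b → weight (a ∩ b) ≤ 1
  ∩-new (block-word h) (block-word h′) a≢b = block-∩-block {h} {h′} (a≢b ∘′ cong block)
  ∩-new (block-word h) (extended-word y∈) _ = block-∩-extendWith h y∈ (pinch? _)
  ∩-new (extended-word {x} x∈) (block-word h) _ =
    subst (_≤ 1) (cong weight (∩-comm (block h) (extend x))) (block-∩-extendWith h x∈ (pinch? x))
  ∩-new (extended-word {x} x∈) (extended-word {y} y∈) a≢b =
    extendWith-∩ x∈ y∈ (a≢b ∘′ cong extend) (pinch? x) (pinch? y)

  2≤weight-new : ∀ {a} → NewWord a → 2 ≤ weight a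
  2≤weight-new na = ≤-trans (≤-trans 2≤k (m≤m+n k 1)) (≤-reflexive (sym (weight-new na)))

  newWords-unique : Unique ws → Unique newWords
  newWords-unique uniq =
    (≢-if-∩≤1 (2≤weight-new (block-word zero)) (block-∩-block {zero} {suc zero} λ ()) All.∷ block≢extended zero)
    AllPairs.∷ block≢extended (suc zero)
    AllPairs.∷ map⁺-on (λ x∈ y∈ x≢y →
      ≢-if-∩≤1 (2≤weight-new (extended-word x∈)) (extendWith-∩ x∈ y∈ x≢y (pinch? _) (pinch? _))) uniq
    where
    block≢extended : ∀ h → All (block h ≢_) (List.map extend ws)
    block≢extended h = All.map⁺ (All.tabulate λ x∈ →
      ≢-if-∩≤1 (2≤weight-new (block-word h)) (block-∩-extendWith h x∈ (pinch? _)))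

  length-newWords : length newWords ≡ length ws + 2
  length-newWords = trans (cong (suc ∘′ suc) (length-map extend ws)) (+-comm 2 (length ws))

  newWords-separated : ∀ a b → a ∈ newWords → b ∈ newWords → a ≢ b → dist a b ≥ 2 * k
  newWords-separated a b a∈ b∈ a≢b =
    c≤1⇒2k≤d {k} (constant-weight-dist a b (weight-new (newWord a∈)) (weight-new (newWord b∈)))
      (∩-new (newWord a∈) (newWord b∈) a≢b)

code-extension : ∀ {k n} → 2 ≤ k → (C : Code n) → HasMinDist C (2 * k) → ConstWeight C (k + 1) →
                 forbidden-bound (k + 1) ((k + 1) + (k + 1)) (2 * suc k) < n →
                 ∃[ C″ ] (HasMinDist {n + (k ∸ 1)} C″ (2 * k) × ConstWeight C″ (k + 1) × ∣ C″ ∣ ≡ ∣ C ∣ + 2)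
code-extension {k} {n} 2≤k C (separated , x₀ , y₀ , x₀∈ , y₀∈ , _ , d₀≡2k) const-weight bound<n =
  code newWords (newWords-unique (unique C)) ,
  ( newWords-separated
  , extend x₀ , extend y₀ , ∈-extended x₀∈ , ∈-extended y₀∈
  , ≢-if-∩≤1 (2≤weight-new (extended-word x₀∈)) (≤-reflexive ∩₀≡1)
  , c≡1⇒d≡2k {k} (constant-weight-dist (extend x₀) (extend y₀) (weight-new (extended-word x₀∈))
                 (weight-new (extended-word y₀∈))) ∩₀≡1) ,
  (λ a a∈ → weight-new (newWord a∈)) ,
  length-newWords
  where
  weights : ∀ {w} → w ∈ words C → weight w ≡ k + 1
  weights = const-weight _

  linear : Linear (words C)
  linear {x} {y} x∈ y∈ x≢y = weight≤1⇒Subsingleton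
    (2k≤d⇒c≤1 {k} (constant-weight-dist x y (weights x∈) (weights y∈)) (separated x y x∈ y∈ x≢y))

  avoid : List (Fin n)
  avoid = points x₀ List.++ points y₀

  length-avoid : length avoid ≡ (k + 1) + (k + 1)
  length-avoid = trans (length-++ (points x₀))
    (cong₂ _+_ (trans (length-points x₀) (weights x₀∈)) (trans (length-points y₀) (weights y₀∈)))

  sparse : ∃[ σ ] Sparsity.Sparse (words C) avoid {2 * suc k} σ
  sparse = Greedy.sparse-exists weights linear avoid (2 * suc k)
    (subst (λ A → forbidden-bound (k + 1) A (2 * suc k) < n) (sym length-avoid) bound<n)

  open Extension 2≤k weights linear (proj₂ sparse)

  ∈-extended : ∀ {x} → x ∈ words C → extend x ∈ newWords
  ∈-extended x∈ = Any.there (Any.there (∈-map⁺ extend x∈))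

  ∩₀≡1 : weight (extend x₀ ∩ extend y₀) ≡ 1
  ∩₀≡1 = begin
    weight (extend x₀ ∩ extend y₀)        ≡⟨ cong₂ (λ a b → weight (a ∩ b)) x₀-kept y₀-kept ⟩
    weight ((x₀ ++ ∅) ∩ (y₀ ++ ∅))        ≡⟨ weight-∩-++ x₀ y₀ ∅ ∅ ⟩
    weight (x₀ ∩ y₀) + weight (∅ {L} ∩ ∅) ≡⟨ cong₂ _+_ x₀∩y₀≡1 (weight-∅∩ (∅ {L})) ⟩
    1                                     ∎
    where
    open ≡-Reasoning
    x₀-kept : extend x₀ ≡ x₀ ++ ∅
    x₀-kept = extend-avoiding (∈-++⁺ˡ ∘′ ∈-points)
    y₀-kept : extend y₀ ≡ y₀ ++ ∅
    y₀-kept = extend-avoiding (∈-++⁺ʳ (points x₀) ∘′ ∈-points)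
    x₀∩y₀≡1 : weight (x₀ ∩ y₀) ≡ 1
    x₀∩y₀≡1 = d≡2k⇒c≡1 {k} (constant-weight-dist x₀ y₀ (weights x₀∈) (weights y₀∈)) d₀≡2k

lemma2 : (k : ℕ) → k ≥ 2 →
    ∃[ N ] ((n : ℕ) → n ≥ N → (C : Code n) →
      HasMinDist C (2 * k) → ConstWeight C (k + 1) →
      ∃[ C'' ] (HasMinDist {n + (k ∸ 1)} C'' (2 * k)
        × ConstWeight C'' (k + 1)
        × ∣ C'' ∣ ≡ ∣ C ∣ + 2))
lemma2 k 2≤k = suc (forbidden-bound (k + 1) ((k + 1) + (k + 1)) (2 * suc k)) ,
  λ n bound<n C dist-2k weight-k+1 → code-extension 2≤k C dist-2k weight-k+1 bound<n
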